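{- Let $q$ be an odd integer and $d\ge1$. Let $\mathcal{P}\subset\mathbb{Z}_q^d$ be a set of points and $\mathcal{S}$ a set of spheres with arbitrary radii in $\mathbb{Z}_q^d$. Then $$\left|I(\mathcal{P},\mathcal{S})-\frac{|\mathcal{P}||\mathcal{S}|}{q}\right|\le\sqrt{2\tau(q)}\,\frac{q^d}{\gamma(q)^{d/2}}\sqrt{|\mathcal{P}||\mathcal{S}|},$$ where $\gamma(q)$ is the smallest prime divisor of $q$ and $\tau(q)$ is the number of divisors of $q$.
   Context: $\mathbb{Z}_q=\mathbb{Z}/q\mathbb{Z}$. A sphere in $\mathbb{Z}_q^d$ with center $a=(a_1,\ldots,a_d)\in\mathbb{Z}_q^d$ and radius $r\in\mathbb{Z}_q$ is the set $\{x\in\mathbb{Z}_q^d:(x_1-a_1)^2+\cdots+(x_d-a_d)^2=r\}$; a set $\mathcal{S}$ of spheres is given as a set of distinct center–radius pairs. $I(\mathcal{P},\mathcal{S})$ is the number of pairs $(p,s)\in\mathcal{P}\times\mathcal{S}$ with $p\in s$. -}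

module Defs where

open import Data.Nat using (ℕ; zero; suc; _+_; _*_; _∸_; _%_; _≤_; NonZero)
open import Data.Nat.Divisibility using (_∣_; _∣?_)
open import Data.Nat.Primality using (Prime)
open import Data.Fin using (Fin; toℕ)
open import Data.Vec using (Vec; zipWith; foldr)
open import Data.List using (List; length; filter; upTo; map)
open import Data.Nat.ListAction using (sum)
open import Data.Product using (_×_; _,_)
open import Relation.Binary.PropositionalEquality using (_≡_)
open import Relation.Nullary using (Dec)
import Data.Nat as ℕ

-- Points of ℤ_q^d : vectors of length d over Fin q (= ℤ/qℤ, canonical reps 0..q-1)
Point : ℕ → ℕ → Set
Point q d = Vec (Fin q) d

Sphere : ℕ → ℕ → Set
Sphere q d = Point q d × Fin q

-- (x - a) in ℤ_q, represented by a natural number congruent to it mod q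
diffℕ : ∀ {q} → Fin q → Fin q → ℕ
diffℕ {q} x a = toℕ x + (q ∸ toℕ a)

sqDistℕ : ∀ {q d} → Point q d → Point q d → ℕ
sqDistℕ x a = foldr _ _+_ 0 (zipWith (λ xi ai → diffℕ xi ai * diffℕ xi ai) x a)

OnSphere : ∀ {q d} .{{_ : NonZero q}} → Point q d → Sphere q d → Set
OnSphere {q} p (a , r) = sqDistℕ p a % q ≡ toℕ r

onSphere? : ∀ {q d} .{{_ : NonZero q}} (p : Point q d) (s : Sphere q d) → Dec (OnSphere p s)
onSphere? {q} p (a , r) = (sqDistℕ p a % q) ℕ.≟ toℕ r

incidences : ∀ {q d} .{{_ : NonZero q}} → List (Point q d) → List (Sphere q d) → ℕ
incidences P S = sum (map (λ s → length (filter (λ p → onSphere? p s) P)) S)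

τ : ℕ → ℕ
τ q = length (filter (λ k → suc k ∣? q) (upTo q))

IsSmallestPrimeDivisor : ℕ → ℕ → Set
IsSmallestPrimeDivisor γ q = Prime γ × γ ∣ q × (∀ p → Prime p → p ∣ q → γ ≤ p)

module Submission where

-- For a sphere s let c(s) be the number of points of P on s. The triangle and Cauchy–Schwarz
-- inequalities give |q I - |P||S||² ≤ |S| · Σ_s (q c(s) - |P|)², the sum running over all q^(d+1)
-- spheres. As every point lies on q^d spheres, this second moment is q² N - |P|² q^(d+1), where N
-- counts the triples (p, p′, s) with p, p′ ∈ P both on s. The centres of the spheres through p and p′
-- solve a linear congruence with at most G q^(d-1) solutions, G = gcd(q, p′ - p) since q is odd.
-- Bounding G by 1 + Σ { e | e ∣ q, e > 1, e ∣ p′ - p } and using that e ∣ p′ - p for at most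
-- (q/e)^d ≤ q^d / γ^d points p′ gives γ^d q N ≤ |P|² γ^d q^d + |P| τ(q) q^(2d+1), hence the bound.

open import Level using (Level; 0ℓ)
open import Defs
open import Data.Nat
  using (ℕ; zero; suc; _+_; _*_; _∸_; _^_; _≤_; _<_; ∣_-_∣; _%_; _/_; _≟_; z≤n; s≤s; z<s; NonZero; ≢-nonZero; ≢-nonZero⁻¹)
open import Data.Nat.Properties
open import Algebra.Properties.CommutativeSemigroup +-commutativeSemigroup
  using () renaming (interchange to +-interchange; xy∙z≈xz∙y to +-swapʳ)
open import Algebra.Properties.CommutativeSemigroup *-commutativeSemigroup using (x∙yz≈y∙xz)
open import Data.Nat.Tactic.RingSolver using (solve-∀)
open import Data.Fin using (Fin; toℕ) renaming (zero to fzero; suc to fsuc)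
import Data.Fin.Properties as Fin
open import Data.Vec using (Vec; []; _∷_)
import Data.Vec.Properties as Vec
open import Data.Nat.Divisibility using (_∣_; divides; _∣?_; >⇒∤; ∣⇒≤; 0∣⇒≡0; ∣-refl; ∣-trans; *-cancelˡ-∣)
open import Data.Nat.GCD using (gcd; gcd[m,n]∣m; gcd[m,n]∣n; gcd[m,n]≢0)
open import Data.Nat.Coprimality using (Coprime; coprime-/gcd; coprime-divisor)
open import Data.Nat.Primality.Factorisation using (factorise)
import Data.Nat.Coprimality as Coprime
open import Data.Nat.DivMod using (m≡m%n+[m/n]*n; m*[n/m]≡n; m%n<n)
open import Data.List using (List; []; _∷_; length; filter; map; upTo)
open import Data.List.Membership.Propositional.Properties using (∈-filter⁺; ∈-filter⁻; ∈-upTo⁺)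
open import Data.List.Membership.Propositional using (_∈_)
open import Data.List.Relation.Unary.All using (All; []; _∷_)
open import Data.List.Relation.Unary.Any using (here; there)
open import Data.List.Relation.Unary.AllPairs using ([]; _∷_)
open import Data.List.Relation.Unary.Unique.Propositional using (Unique)
open import Data.Nat.ListAction using (sum; product)
open import Data.Product using (Σ; _×_; _,_; proj₂)
import Data.Product.Properties as Product
open import Data.Empty using (⊥-elim)
open import Data.Sum using (inj₁; inj₂)
open import Relation.Nullary using (¬_; Dec; yes; no; contradiction)
open import Relation.Nullary.Decidable using (_×-dec_; map′)
open import Relation.Unary using (Pred; Decidable)
open import Relation.Binary using (DecidableEquality; Setoid)
import Relation.Binary.Reasoning.Setoid as SetoidReasoning
open import Relation.Binary.PropositionalEquality
open import Function using (_∘_)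

private
  variable
    a b : Level
    A B : Set a

𝟙 : Dec A → ℕ
𝟙 (yes _) = 1
𝟙 (no _)  = 0

𝟙≤1 : (a? : Dec A) → 𝟙 a? ≤ 1
𝟙≤1 (yes _) = s≤s z≤n
𝟙≤1 (no _)  = z≤n

𝟙-yes : A → (a? : Dec A) → 𝟙 a? ≡ 1
𝟙-yes _ (yes _) = refl
𝟙-yes a (no ¬a) = ⊥-elim (¬a a)

𝟙-no : ¬ A → (a? : Dec A) → 𝟙 a? ≡ 0
𝟙-no ¬a (yes a) = ⊥-elim (¬a a)
𝟙-no _  (no _)  = refl

𝟙-mono : (A → B) → (a? : Dec A) (b? : Dec B) → 𝟙 a? ≤ 𝟙 b?
𝟙-mono f (yes a) b?     = ≤-reflexive (sym (𝟙-yes (f a) b?))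
𝟙-mono f (no _)  _      = z≤n

𝟙-cong : (A → B) → (B → A) → (a? : Dec A) (b? : Dec B) → 𝟙 a? ≡ 𝟙 b?
𝟙-cong f g a? b? = ≤-antisym (𝟙-mono f a? b?) (𝟙-mono g b? a?)

𝟙-× : (a? : Dec A) (b? : Dec B) → 𝟙 (a? ×-dec b?) ≡ 𝟙 a? * 𝟙 b?
𝟙-× (yes _) (yes _) = refl
𝟙-× (yes _) (no _)  = refl
𝟙-× (no _)  _       = refl

-- Summation

listSum : List A → (A → ℕ) → ℕ
listSum xs f = sum (map f xs)

record IsSummation {a} {X : Set a} (∑ : (X → ℕ) → ℕ) : Set a where
  field
    ∑-cong : ∀ {f g} → (∀ x → f x ≡ g x) → ∑ f ≡ ∑ g
    ∑-0    : ∑ (λ _ → 0) ≡ 0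
    ∑-+    : ∀ f g → ∑ (λ x → f x + g x) ≡ ∑ f + ∑ g
    ∑-mono : ∀ {f g} → (∀ x → f x ≤ g x) → ∑ f ≤ ∑ g

  ∑-*ˡ : ∀ c f → ∑ (λ x → c * f x) ≡ c * ∑ f
  ∑-*ˡ zero    f = ∑-0
  ∑-*ˡ (suc c) f = trans (∑-+ f (λ x → c * f x)) (cong (∑ f +_) (∑-*ˡ c f))

  ∑-*ʳ : ∀ c f → ∑ (λ x → f x * c) ≡ ∑ f * c
  ∑-*ʳ c f = trans (∑-cong (λ x → *-comm (f x) c)) (trans (∑-*ˡ c f) (*-comm c (∑ f)))

  ∑-listSum-comm : ∀ {b} {B : Set b} (ys : List B) (f : X → B → ℕ) →
                   ∑ (λ x → listSum ys (f x)) ≡ listSum ys (λ y → ∑ (λ x → f x y))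
  ∑-listSum-comm []       f = ∑-0
  ∑-listSum-comm (y ∷ ys) f =
    trans (∑-+ (λ x → f x y) (λ x → listSum ys (f x))) (cong (∑ (λ x → f x y) +_) (∑-listSum-comm ys f))

open IsSummation

listSum-isSummation : (xs : List A) → IsSummation (listSum xs)
listSum-isSummation xs = record { ∑-cong = pointwise xs ; ∑-0 = vanishing xs ; ∑-+ = additive xs ; ∑-mono = monotone xs }
  where
  pointwise : ∀ xs {f g} → (∀ x → f x ≡ g x) → listSum xs f ≡ listSum xs g
  pointwise []       f≡g = refl
  pointwise (x ∷ xs) f≡g = cong₂ _+_ (f≡g x) (pointwise xs f≡g)
  vanishing : ∀ xs → listSum xs (λ _ → 0) ≡ 0
  vanishing []       = refl
  vanishing (x ∷ xs) = vanishing xs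
  additive : ∀ xs f g → listSum xs (λ x → f x + g x) ≡ listSum xs f + listSum xs g
  additive []       f g = refl
  additive (x ∷ xs) f g = trans (cong (f x + g x +_) (additive xs f g)) (+-interchange (f x) (g x) _ _)
  monotone : ∀ xs {f g} → (∀ x → f x ≤ g x) → listSum xs f ≤ listSum xs g
  monotone []       f≤g = z≤n
  monotone (x ∷ xs) f≤g = +-mono-≤ (f≤g x) (monotone xs f≤g)

finSum : ∀ n → (Fin n → ℕ) → ℕ
finSum zero    f = 0
finSum (suc n) f = f fzero + finSum n (f ∘ fsuc)

finSum-isSummation : ∀ n → IsSummation (finSum n)
finSum-isSummation n = record { ∑-cong = pointwise n ; ∑-0 = vanishing n ; ∑-+ = additive n ; ∑-mono = monotone n }
  where
  pointwise : ∀ n {f g} → (∀ x → f x ≡ g x) → finSum n f ≡ finSum n g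
  pointwise zero    f≡g = refl
  pointwise (suc n) f≡g = cong₂ _+_ (f≡g fzero) (pointwise n (f≡g ∘ fsuc))
  vanishing : ∀ n → finSum n (λ _ → 0) ≡ 0
  vanishing zero    = refl
  vanishing (suc n) = vanishing n
  additive : ∀ n f g → finSum n (λ x → f x + g x) ≡ finSum n f + finSum n g
  additive zero    f g = refl
  additive (suc n) f g =
    trans (cong (f fzero + g fzero +_) (additive n (f ∘ fsuc) (g ∘ fsuc))) (+-interchange (f fzero) (g fzero) _ _)
  monotone : ∀ n {f g} → (∀ x → f x ≤ g x) → finSum n f ≤ finSum n g
  monotone zero    f≤g = z≤n
  monotone (suc n) f≤g = +-mono-≤ (f≤g fzero) (monotone n (f≤g ∘ fsuc))

natSum : ℕ → (ℕ → ℕ) → ℕ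
natSum zero    f = 0
natSum (suc n) f = f 0 + natSum n (f ∘ suc)

natSum-isSummation : ∀ n → IsSummation (natSum n)
natSum-isSummation n = record { ∑-cong = pointwise n ; ∑-0 = vanishing n ; ∑-+ = additive n ; ∑-mono = monotone n }
  where
  pointwise : ∀ n {f g} → (∀ x → f x ≡ g x) → natSum n f ≡ natSum n g
  pointwise zero    f≡g = refl
  pointwise (suc n) f≡g = cong₂ _+_ (f≡g 0) (pointwise n (f≡g ∘ suc))
  vanishing : ∀ n → natSum n (λ _ → 0) ≡ 0
  vanishing zero    = refl
  vanishing (suc n) = vanishing n
  additive : ∀ n f g → natSum n (λ x → f x + g x) ≡ natSum n f + natSum n g
  additive zero    f g = refl
  additive (suc n) f g =
    trans (cong (f 0 + g 0 +_) (additive n (f ∘ suc) (g ∘ suc))) (+-interchange (f 0) (g 0) _ _)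
  monotone : ∀ n {f g} → (∀ x → f x ≤ g x) → natSum n f ≤ natSum n g
  monotone zero    f≤g = z≤n
  monotone (suc n) f≤g = +-mono-≤ (f≤g 0) (monotone n (f≤g ∘ suc))

finSum-toℕ : ∀ n (f : ℕ → ℕ) → finSum n (f ∘ toℕ) ≡ natSum n f
finSum-toℕ zero    f = refl
finSum-toℕ (suc n) f = cong (f 0 +_) (finSum-toℕ n (f ∘ suc))

nested-isSummation : ∀ {c} {Y : Set b} {Z : Set c} {∑₁ : (A → ℕ) → ℕ} {∑₂ : (Y → ℕ) → ℕ} →
                     IsSummation ∑₁ → IsSummation ∑₂ → (h : A → Y → Z) →
                     IsSummation (λ f → ∑₁ (λ x → ∑₂ (λ y → f (h x y))))
nested-isSummation isΣ₁ isΣ₂ h = record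
  { ∑-cong = λ f≡g → ∑-cong isΣ₁ (λ x → ∑-cong isΣ₂ (λ y → f≡g (h x y)))
  ; ∑-0    = trans (∑-cong isΣ₁ (λ _ → ∑-0 isΣ₂)) (∑-0 isΣ₁)
  ; ∑-+    = λ f g → trans (∑-cong isΣ₁ (λ _ → ∑-+ isΣ₂ _ _)) (∑-+ isΣ₁ _ _)
  ; ∑-mono = λ f≤g → ∑-mono isΣ₁ (λ x → ∑-mono isΣ₂ (λ y → f≤g (h x y)))
  }

pointSum : ∀ q d → (Point q d → ℕ) → ℕ
pointSum q zero    f = f []
pointSum q (suc d) f = finSum q (λ x → pointSum q d (λ v → f (x ∷ v)))

pointSum-isSummation : ∀ q d → IsSummation (pointSum q d)
pointSum-isSummation q zero    =
  record { ∑-cong = λ f≡g → f≡g [] ; ∑-0 = refl ; ∑-+ = λ _ _ → refl ; ∑-mono = λ f≤g → f≤g [] }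
pointSum-isSummation q (suc d) = nested-isSummation (finSum-isSummation q) (pointSum-isSummation q d) _∷_

sphereSum : ∀ q d → (Sphere q d → ℕ) → ℕ
sphereSum q d f = pointSum q d (λ a → finSum q (λ r → f (a , r)))

sphereSum-isSummation : ∀ q d → IsSummation (sphereSum q d)
sphereSum-isSummation q d = nested-isSummation (pointSum-isSummation q d) (finSum-isSummation q) _,_

listSum-const : ∀ (xs : List A) c → listSum xs (λ _ → c) ≡ length xs * c
listSum-const []       c = refl
listSum-const (x ∷ xs) c = cong (c +_) (listSum-const xs c)

∈⇒≤listSum : ∀ {xs : List A} {x} (f : A → ℕ) → x ∈ xs → f x ≤ listSum xs f
∈⇒≤listSum {xs = y ∷ xs} f (here refl) = m≤m+n (f y) (listSum xs f)
∈⇒≤listSum {xs = y ∷ xs} f (there x∈xs) = ≤-trans (∈⇒≤listSum f x∈xs) (m≤n+m (listSum xs f) (f y))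

listSum-mono-∈ : ∀ (xs : List A) {f g : A → ℕ} → (∀ x → x ∈ xs → f x ≤ g x) → listSum xs f ≤ listSum xs g
listSum-mono-∈ []       f≤g = z≤n
listSum-mono-∈ (x ∷ xs) f≤g = +-mono-≤ (f≤g x (here refl)) (listSum-mono-∈ xs (λ y → f≤g y ∘ there))

length-filter : ∀ {p} {P : Pred A p} (P? : Decidable P) xs → length (filter P? xs) ≡ listSum xs (𝟙 ∘ P?)
length-filter P? []       = refl
length-filter P? (x ∷ xs) with P? x
... | yes _ = cong suc (length-filter P? xs)
... | no _  = length-filter P? xs

∣-∣-+ˡ : ∀ c m n → ∣ c + m - c + n ∣ ≡ ∣ m - n ∣
∣-∣-+ˡ zero    m n = refl
∣-∣-+ˡ (suc c) m n = ∣-∣-+ˡ c m n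

∣-∣-+ʳ : ∀ c m n → ∣ m + c - n + c ∣ ≡ ∣ m - n ∣
∣-∣-+ʳ c m n = trans (cong₂ ∣_-_∣ (+-comm m c) (+-comm n c)) (∣-∣-+ˡ c m n)

∣listSum-listSum∣≤ : ∀ (xs : List A) f g →
                     ∣ listSum xs f - listSum xs g ∣ ≤ listSum xs (λ x → ∣ f x - g x ∣)
∣listSum-listSum∣≤ []       f g = z≤n
∣listSum-listSum∣≤ (x ∷ xs) f g = begin
  ∣ f x + F - g x + G ∣                         ≤⟨ ∣-∣-triangle (f x + F) (g x + F) (g x + G) ⟩
  ∣ f x + F - g x + F ∣ + ∣ g x + F - g x + G ∣  ≡⟨ cong₂ _+_ (∣-∣-+ʳ F (f x) (g x)) (∣-∣-+ˡ (g x) F G) ⟩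
  ∣ f x - g x ∣ + ∣ F - G ∣                      ≤⟨ +-monoʳ-≤ ∣ f x - g x ∣ (∣listSum-listSum∣≤ xs f g) ⟩
  ∣ f x - g x ∣ + listSum xs (λ x → ∣ f x - g x ∣) ∎
  where
  open ≤-Reasoning
  F G : ℕ
  F = listSum xs f
  G = listSum xs g

private
  ∣m-m+t∣≡t : ∀ m t → ∣ m - m + t ∣ ≡ t
  ∣m-m+t∣≡t zero    t = refl
  ∣m-m+t∣≡t (suc m) t = ∣m-m+t∣≡t m t

  ≤⇒∣-∣²+2*≡ : ∀ {m n} → m ≤ n → ∣ m - n ∣ * ∣ m - n ∣ + 2 * m * n ≡ m * m + n * n
  ≤⇒∣-∣²+2*≡ {m} {n} m≤n with n ∸ m | m+[n∸m]≡n m≤n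
  ... | t | refl rewrite ∣m-m+t∣≡t m t = identity m t
    where
    identity : ∀ m t → t * t + 2 * m * (m + t) ≡ m * m + (m + t) * (m + t)
    identity = solve-∀

∣-∣²+2*≡ : ∀ m n → ∣ m - n ∣ * ∣ m - n ∣ + 2 * m * n ≡ m * m + n * n
∣-∣²+2*≡ m n with ≤-total m n
... | inj₁ m≤n = ≤⇒∣-∣²+2*≡ m≤n
... | inj₂ n≤m = begin
  ∣ m - n ∣ * ∣ m - n ∣ + 2 * m * n ≡⟨ cong₂ _+_ (cong₂ _*_ (∣-∣-comm m n) (∣-∣-comm m n)) (swap m n) ⟩
  ∣ n - m ∣ * ∣ n - m ∣ + 2 * n * m ≡⟨ ≤⇒∣-∣²+2*≡ n≤m ⟩
  n * n + m * m                     ≡⟨ +-comm (n * n) (m * m) ⟩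
  m * m + n * n                     ∎
  where
  open ≡-Reasoning
  swap : ∀ m n → 2 * m * n ≡ 2 * n * m
  swap = solve-∀

-- Lagrange's argument: sum ∣ f x - f y ∣² + 2 f x f y = f x² + f y² over all pairs (x , y).
cauchy-schwarz : ∀ (xs : List A) f → listSum xs f * listSum xs f ≤ length xs * listSum xs (λ x → f x * f x)
cauchy-schwarz {A = A} xs f = *-cancelˡ-≤ 2 (begin
  2 * (F * F)
    ≡⟨ double-product ⟩
  ∑ (λ x → ∑ (λ y → 2 * f x * f y))
    ≤⟨ ∑-mono isΣ (λ x → ∑-mono isΣ (λ y → m≤n+m _ _)) ⟩
  ∑ (λ x → ∑ (λ y → ∣ f x - f y ∣ * ∣ f x - f y ∣ + 2 * f x * f y))
    ≡⟨ ∑-cong isΣ (λ x → ∑-cong isΣ (λ y → ∣-∣²+2*≡ (f x) (f y))) ⟩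
  ∑ (λ x → ∑ (λ y → f x * f x + f y * f y))
    ≡⟨ sum-of-squares ⟩
  2 * (n * Q) ∎)
  where
  open ≤-Reasoning
  ∑ : (A → ℕ) → ℕ
  ∑ = listSum xs
  isΣ : IsSummation ∑
  isΣ = listSum-isSummation xs
  F Q n : ℕ
  F = ∑ f
  Q = ∑ (λ x → f x * f x)
  n = length xs
  double-product : 2 * (F * F) ≡ ∑ (λ x → ∑ (λ y → 2 * f x * f y))
  double-product = sym (begin-equality
    ∑ (λ x → ∑ (λ y → 2 * f x * f y)) ≡⟨ ∑-cong isΣ (λ x → ∑-*ˡ isΣ (2 * f x) f) ⟩
    ∑ (λ x → 2 * f x * F)             ≡⟨ ∑-*ʳ isΣ F (λ x → 2 * f x) ⟩
    ∑ (λ x → 2 * f x) * F             ≡⟨ cong (_* F) (∑-*ˡ isΣ 2 f) ⟩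
    2 * F * F                         ≡⟨ *-assoc 2 F F ⟩
    2 * (F * F)                       ∎)
  sum-of-squares : ∑ (λ x → ∑ (λ y → f x * f x + f y * f y)) ≡ 2 * (n * Q)
  sum-of-squares = begin-equality
    ∑ (λ x → ∑ (λ y → f x * f x + f y * f y)) ≡⟨ ∑-cong isΣ (λ x → ∑-+ isΣ (λ _ → f x * f x) _) ⟩
    ∑ (λ x → ∑ (λ _ → f x * f x) + Q)         ≡⟨ ∑-cong isΣ (λ x → cong (_+ Q) (listSum-const xs (f x * f x))) ⟩
    ∑ (λ x → n * (f x * f x) + Q)             ≡⟨ ∑-+ isΣ (λ x → n * (f x * f x)) (λ _ → Q) ⟩
    ∑ (λ x → n * (f x * f x)) + ∑ (λ _ → Q)   ≡⟨ cong₂ _+_ (∑-*ˡ isΣ n (λ x → f x * f x)) (listSum-const xs Q) ⟩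
    n * Q + n * Q                             ≡⟨ cong (n * Q +_) (sym (+-identityʳ (n * Q))) ⟩
    2 * (n * Q)                               ∎

Sifts : ∀ {a} {A : Set a} → ((A → ℕ) → ℕ) → DecidableEquality A → Set a
Sifts {A = A} ∑ _≟_ = ∀ (x : A) (g : A → ℕ) → ∑ (λ y → 𝟙 (x ≟ y) * g y) ≡ g x

unique⇒count≤1 : (_≟_ : DecidableEquality A) (xs : List A) → Unique xs →
                 ∀ y → listSum xs (λ x → 𝟙 (x ≟ y)) ≤ 1
unique⇒count≤1 _≟_ []       _            y = z≤n
unique⇒count≤1 _≟_ (x ∷ xs) (x∉xs ∷ uxs) y with x ≟ y
... | yes refl = ≤-reflexive (cong suc (absent xs x∉xs))
  where
  absent : ∀ zs → All (x ≢_) zs → listSum zs (λ z → 𝟙 (z ≟ x)) ≡ 0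
  absent []       []             = refl
  absent (z ∷ zs) (x≢z ∷ x∉zs) = cong₂ _+_ (𝟙-no (x≢z ∘ sym) (z ≟ x)) (absent zs x∉zs)
... | no _     = unique⇒count≤1 _≟_ xs uxs y

unique⇒listSum≤∑ : ∀ {∑ : (A → ℕ) → ℕ} {_≟_ : DecidableEquality A} → IsSummation ∑ → Sifts ∑ _≟_ →
                   (xs : List A) → Unique xs → ∀ f → listSum xs f ≤ ∑ f
unique⇒listSum≤∑ {∑ = ∑} {_≟_} isΣ sifts xs uxs f = begin
  listSum xs f                                 ≡⟨ ∑-cong isL (λ x → sifts x f) ⟨
  listSum xs (λ x → ∑ (λ y → 𝟙 (x ≟ y) * f y)) ≡⟨ ∑-listSum-comm isΣ xs (λ y x → 𝟙 (x ≟ y) * f y) ⟨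
  ∑ (λ y → listSum xs (λ x → 𝟙 (x ≟ y) * f y)) ≡⟨ ∑-cong isΣ (λ y → ∑-*ʳ isL (f y) (λ x → 𝟙 (x ≟ y))) ⟩
  ∑ (λ y → listSum xs (λ x → 𝟙 (x ≟ y)) * f y) ≤⟨ ∑-mono isΣ (λ y → *-monoˡ-≤ (f y) (count≤1 y)) ⟩
  ∑ (λ y → 1 * f y)                            ≡⟨ ∑-cong isΣ (λ y → *-identityˡ (f y)) ⟩
  ∑ f                                          ∎
  where
  open ≤-Reasoning
  isL : IsSummation (listSum xs)
  isL = listSum-isSummation xs
  count≤1 : ∀ y → listSum xs (λ x → 𝟙 (x ≟ y)) ≤ 1
  count≤1 = unique⇒count≤1 _≟_ xs uxs

finSum-sifts : ∀ n → Sifts (finSum n) Fin._≟_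
finSum-sifts (suc n) fzero    g =
  trans (cong₂ _+_ (+-identityʳ (g fzero)) (∑-0 (finSum-isSummation n))) (+-identityʳ (g fzero))
finSum-sifts (suc n) (fsuc x) g = trans (∑-cong (finSum-isSummation n) (λ y → cong (_* g (fsuc y))
  (𝟙-cong Fin.suc-injective (cong fsuc) (fsuc x Fin.≟ fsuc y) (x Fin.≟ y)))) (finSum-sifts n x (g ∘ fsuc))

nested-sifts : ∀ {c} {Y : Set b} {Z : Set c} {∑₁ : (A → ℕ) → ℕ} {∑₂ : (Y → ℕ) → ℕ}
               {_≟₁_ : DecidableEquality A} {_≟₂_ : DecidableEquality Y} (_≟_ : DecidableEquality Z) →
               IsSummation ∑₁ → IsSummation ∑₂ → Sifts ∑₁ _≟₁_ → Sifts ∑₂ _≟₂_ →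
               (h : A → Y → Z) → (∀ {x y x′ y′} → h x y ≡ h x′ y′ → x ≡ x′ × y ≡ y′) →
               (∀ z → Σ A λ x → Σ Y λ y → h x y ≡ z) →
               Sifts (λ f → ∑₁ (λ x → ∑₂ (λ y → f (h x y)))) _≟_
nested-sifts {∑₁ = ∑₁} {∑₂} {_≟₁_} {_≟₂_} _≟_ isΣ₁ isΣ₂ sifts₁ sifts₂ h h-injective h-surjective z g
  with h-surjective z
... | x , y , refl = begin
  ∑₁ (λ x′ → ∑₂ (λ y′ → 𝟙 (h x y ≟ h x′ y′) * g (h x′ y′)))
    ≡⟨ ∑-cong isΣ₁ (λ x′ → ∑-cong isΣ₂ (λ y′ → cong (_* g (h x′ y′)) (split x′ y′))) ⟩
  ∑₁ (λ x′ → ∑₂ (λ y′ → 𝟙 (x ≟₁ x′) * 𝟙 (y ≟₂ y′) * g (h x′ y′)))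
    ≡⟨ ∑-cong isΣ₁ (λ x′ → trans (∑-cong isΣ₂ (λ y′ → *-assoc (𝟙 (x ≟₁ x′)) _ _)) (∑-*ˡ isΣ₂ (𝟙 (x ≟₁ x′)) _)) ⟩
  ∑₁ (λ x′ → 𝟙 (x ≟₁ x′) * ∑₂ (λ y′ → 𝟙 (y ≟₂ y′) * g (h x′ y′)))
    ≡⟨ sifts₁ x _ ⟩
  ∑₂ (λ y′ → 𝟙 (y ≟₂ y′) * g (h x y′))
    ≡⟨ sifts₂ y (g ∘ h x) ⟩
  g (h x y) ∎
  where
  open ≡-Reasoning
  split : ∀ x′ y′ → 𝟙 (h x y ≟ h x′ y′) ≡ 𝟙 (x ≟₁ x′) * 𝟙 (y ≟₂ y′)
  split x′ y′ = trans
    (𝟙-cong h-injective (λ { (refl , refl) → refl }) (h x y ≟ h x′ y′) ((x ≟₁ x′) ×-dec (y ≟₂ y′)))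
    (𝟙-× (x ≟₁ x′) (y ≟₂ y′))

_≟ᴾ_ : ∀ {q d} → DecidableEquality (Point q d)
_≟ᴾ_ = Vec.≡-dec Fin._≟_

_≟ˢ_ : ∀ {q d} → DecidableEquality (Sphere q d)
_≟ˢ_ = Product.≡-dec _≟ᴾ_ Fin._≟_

pointSum-sifts : ∀ q d → Sifts (pointSum q d) _≟ᴾ_
pointSum-sifts q zero    [] g = *-identityˡ (g [])
pointSum-sifts q (suc d)    = nested-sifts {_≟₁_ = Fin._≟_} {_≟₂_ = _≟ᴾ_} _≟ᴾ_
  (finSum-isSummation q) (pointSum-isSummation q d) (finSum-sifts q) (pointSum-sifts q d)
  _∷_ (λ eq → Vec.∷-injectiveˡ eq , Vec.∷-injectiveʳ eq) (λ { (x ∷ v) → x , v , refl })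

sphereSum-sifts : ∀ q d → Sifts (sphereSum q d) _≟ˢ_
sphereSum-sifts q d = nested-sifts {_≟₁_ = _≟ᴾ_} {_≟₂_ = Fin._≟_} _≟ˢ_
  (pointSum-isSummation q d) (finSum-isSummation q) (pointSum-sifts q d) (finSum-sifts q)
  _,_ (λ { refl → refl , refl }) (λ { (a , r) → a , r , refl })

natSum-split : ∀ m n f → natSum (m + n) f ≡ natSum m f + natSum n (λ x → f (m + x))
natSum-split zero    n f = refl
natSum-split (suc m) n f = trans (cong (f 0 +_) (natSum-split m n (f ∘ suc))) (sym (+-assoc (f 0) _ _))

natSum-zero : ∀ n f → (∀ x → x < n → f x ≡ 0) → natSum n f ≡ 0
natSum-zero zero    f f≡0 = refl
natSum-zero (suc n) f f≡0 = cong₂ _+_ (f≡0 0 z<s) (natSum-zero n (f ∘ suc) (λ x x<n → f≡0 (suc x) (s≤s x<n)))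

natSum-𝟙≤1 : ∀ {p} {P : Pred ℕ p} n (P? : Decidable P) →
             (∀ {x y} → x < n → y < n → P x → P y → x ≡ y) → natSum n (𝟙 ∘ P?) ≤ 1
natSum-𝟙≤1 zero    P? unique = z≤n
natSum-𝟙≤1 (suc n) P? unique with P? 0
... | yes P0 = ≤-reflexive (cong suc (natSum-zero n _ (λ x x<n →
                 𝟙-no (λ Px → 0≢1+n (unique z<s (s≤s x<n) P0 Px)) (P? (suc x)))))
... | no _   = natSum-𝟙≤1 n (P? ∘ suc) (λ x<n y<n Px Py → suc-injective (unique (s≤s x<n) (s≤s y<n) Px Py))

natSum-𝟙≢0⇒∃ : ∀ {p} {P : Pred ℕ p} n (P? : Decidable P) →
               natSum n (𝟙 ∘ P?) ≢ 0 → Σ ℕ λ x → x < n × P x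
natSum-𝟙≢0⇒∃ zero    P? ≢0 = ⊥-elim (≢0 refl)
natSum-𝟙≢0⇒∃ (suc n) P? ≢0 with P? 0
... | yes P0 = 0 , z<s , P0
... | no _ with natSum-𝟙≢0⇒∃ n (P? ∘ suc) ≢0
...   | x , x<n , Px = suc x , s≤s x<n , Px

natSum-sifts : ∀ n k (g : ℕ → ℕ) → k < n → natSum n (λ j → 𝟙 (k ≟ j) * g j) ≡ g k
natSum-sifts (suc n) zero    g _ = trans (cong₂ _+_ (+-identityʳ (g 0)) rest) (+-identityʳ (g 0))
  where
  rest : natSum n (λ j → 𝟙 (0 ≟ suc j) * g (suc j)) ≡ 0
  rest = natSum-zero n _ (λ j _ → cong (_* g (suc j)) (𝟙-no 0≢1+n (0 ≟ suc j)))
natSum-sifts (suc n) (suc k) g (s≤s k<n) = trans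
  (∑-cong (natSum-isSummation n) (λ j → cong (_* g (suc j))
    (𝟙-cong suc-injective (cong suc) (suc k ≟ suc j) (k ≟ j))))
  (natSum-sifts n k (g ∘ suc) k<n)

finSum-sifts-toℕ : ∀ n k (g : ℕ → ℕ) → k < n → finSum n (λ r → 𝟙 (k ≟ toℕ r) * g (toℕ r)) ≡ g k
finSum-sifts-toℕ n k g k<n = trans (finSum-toℕ n (λ j → 𝟙 (k ≟ j) * g j)) (natSum-sifts n k g k<n)

finSum-const : ∀ n c → finSum n (λ _ → c) ≡ n * c
finSum-const zero    c = refl
finSum-const (suc n) c = cong (c +_) (finSum-const n c)

pointSum-const : ∀ q d c → pointSum q d (λ _ → c) ≡ q ^ d * c
pointSum-const q zero    c = sym (+-identityʳ c)
pointSum-const q (suc d) c = begin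
  finSum q (λ _ → pointSum q d (λ _ → c)) ≡⟨ ∑-cong (finSum-isSummation q) (λ _ → pointSum-const q d c) ⟩
  finSum q (λ _ → q ^ d * c)              ≡⟨ finSum-const q (q ^ d * c) ⟩
  q * (q ^ d * c)                         ≡⟨ *-assoc q (q ^ d) c ⟨
  q * q ^ d * c                           ∎
  where open ≡-Reasoning

-- Congruences

infix 4 _≡_mod_ _≡?_mod_

_≡_mod_ : ℕ → ℕ → ℕ → Set
a ≡ b mod g = Σ ℕ λ k → Σ ℕ λ l → a + k * g ≡ b + l * g

module _ {g : ℕ} where

  ≡mod-refl : ∀ {a} → a ≡ a mod g
  ≡mod-refl = 0 , 0 , refl

  ≡⇒≡mod : ∀ {a b} → a ≡ b → a ≡ b mod g
  ≡⇒≡mod refl = ≡mod-refl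

  ≡mod-sym : ∀ {a b} → a ≡ b mod g → b ≡ a mod g
  ≡mod-sym (k , l , eq) = l , k , sym eq

  ≡mod-trans : ∀ {a b c} → a ≡ b mod g → b ≡ c mod g → a ≡ c mod g
  ≡mod-trans {a} {b} {c} (k , l , eq) (k′ , l′ , eq′) = k + k′ , l + l′ , (begin
    a + (k + k′) * g       ≡⟨ shift a k k′ g ⟩
    (a + k * g) + k′ * g   ≡⟨ cong (_+ k′ * g) eq ⟩
    (b + l * g) + k′ * g   ≡⟨ swap b l k′ g ⟩
    (b + k′ * g) + l * g   ≡⟨ cong (_+ l * g) eq′ ⟩
    (c + l′ * g) + l * g   ≡⟨ shift′ c l′ l g ⟩
    c + (l + l′) * g       ∎)
    where
    open ≡-Reasoning
    shift : ∀ a k k′ g → a + (k + k′) * g ≡ (a + k * g) + k′ * g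
    shift = solve-∀
    swap : ∀ b l k′ g → (b + l * g) + k′ * g ≡ (b + k′ * g) + l * g
    swap = solve-∀
    shift′ : ∀ c l′ l g → (c + l′ * g) + l * g ≡ c + (l + l′) * g
    shift′ = solve-∀

  ≡mod-+ : ∀ {a b c d} → a ≡ b mod g → c ≡ d mod g → a + c ≡ b + d mod g
  ≡mod-+ {a} {b} {c} {d} (k , l , eq) (k′ , l′ , eq′) = k + k′ , l + l′ , (begin
    a + c + (k + k′) * g       ≡⟨ regroup a c k k′ g ⟩
    (a + k * g) + (c + k′ * g) ≡⟨ cong₂ _+_ eq eq′ ⟩
    (b + l * g) + (d + l′ * g) ≡⟨ regroup b d l l′ g ⟨
    b + d + (l + l′) * g       ∎)
    where
    open ≡-Reasoning
    regroup : ∀ a c k k′ g → a + c + (k + k′) * g ≡ (a + k * g) + (c + k′ * g)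
    regroup = solve-∀

  ≡mod-cancelʳ-+ : ∀ {a b} c → a + c ≡ b + c mod g → a ≡ b mod g
  ≡mod-cancelʳ-+ {a} {b} c (k , l , eq) = k , l , +-cancelʳ-≡ c _ _ (begin
    a + k * g + c ≡⟨ +-swapʳ a (k * g) c ⟩
    a + c + k * g ≡⟨ eq ⟩
    b + c + l * g ≡⟨ +-swapʳ b (l * g) c ⟨
    b + l * g + c ∎)
    where
    open ≡-Reasoning

  ≡mod⇒∣∣-∣ : ∀ {a b} → a ≡ b mod g → g ∣ ∣ a - b ∣
  ≡mod⇒∣∣-∣ {a} {b} (k , l , eq) = divides ∣ k - l ∣ (begin
    ∣ a - b ∣                                       ≡⟨ ∣-∣-+ʳ (k * g + l * g) a b ⟨
    ∣ a + (k * g + l * g) - b + (k * g + l * g) ∣   ≡⟨ cong₂ ∣_-_∣ (regroup a _ _) (regroup′ b _ _) ⟩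
    ∣ (a + k * g) + l * g - (b + l * g) + k * g ∣   ≡⟨ cong (λ z → ∣ z + l * g - (b + l * g) + k * g ∣) eq ⟩
    ∣ (b + l * g) + l * g - (b + l * g) + k * g ∣   ≡⟨ ∣-∣-+ˡ (b + l * g) (l * g) (k * g) ⟩
    ∣ l * g - k * g ∣                               ≡⟨ *-distribʳ-∣-∣ g l k ⟨
    ∣ l - k ∣ * g                                   ≡⟨ cong (_* g) (∣-∣-comm l k) ⟩
    ∣ k - l ∣ * g                                   ∎)
    where
    open ≡-Reasoning
    regroup : ∀ a x y → a + (x + y) ≡ (a + x) + y
    regroup = solve-∀
    regroup′ : ∀ b x y → b + (x + y) ≡ (b + y) + x
    regroup′ = solve-∀

  private
    ∣∣-∣⇒≡mod-≤ : ∀ {a b} → a ≤ b → g ∣ ∣ a - b ∣ → a ≡ b mod g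
    ∣∣-∣⇒≡mod-≤ {a} {b} a≤b (divides j eq) = j , 0 , (begin
      a + j * g       ≡⟨ cong (a +_) eq ⟨
      a + ∣ a - b ∣   ≡⟨ cong (a +_) (m≤n⇒∣m-n∣≡n∸m a≤b) ⟩
      a + (b ∸ a)     ≡⟨ m+[n∸m]≡n a≤b ⟩
      b               ≡⟨ +-identityʳ b ⟨
      b + 0 * g       ∎)
      where open ≡-Reasoning

  ∣∣-∣⇒≡mod : ∀ {a b} → g ∣ ∣ a - b ∣ → a ≡ b mod g
  ∣∣-∣⇒≡mod {a} {b} g∣ with ≤-total a b
  ... | inj₁ a≤b = ∣∣-∣⇒≡mod-≤ a≤b g∣
  ... | inj₂ b≤a = ≡mod-sym (∣∣-∣⇒≡mod-≤ b≤a (subst (g ∣_) (∣-∣-comm a b) g∣))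

≡mod-setoid : ℕ → Setoid 0ℓ 0ℓ
≡mod-setoid g = record
  { Carrier       = ℕ
  ; _≈_           = λ a b → a ≡ b mod g
  ; isEquivalence = record { refl = ≡mod-refl ; sym = ≡mod-sym ; trans = ≡mod-trans }
  }

module ≡mod-Reasoning (g : ℕ) = SetoidReasoning (≡mod-setoid g)

_≡?_mod_ : ∀ a b g → Dec (a ≡ b mod g)
a ≡? b mod g = map′ ∣∣-∣⇒≡mod ≡mod⇒∣∣-∣ (g ∣? ∣ a - b ∣)

∣⇒≡mod : ∀ {h g a b} → h ∣ g → a ≡ b mod g → a ≡ b mod h
∣⇒≡mod {h} {a = a} {b} (divides t refl) (k , l , eq) =
  k * t , l * t , trans (cong (a +_) (*-assoc k t h)) (trans eq (cong (b +_) (sym (*-assoc l t h))))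

∣⇒*≡0mod : ∀ {h v} x → h ∣ v → v * x ≡ 0 mod h
∣⇒*≡0mod {h} x (divides t refl) = 0 , t * x , trans (+-identityʳ _) (rearrange t h x)
  where
  rearrange : ∀ t h x → t * h * x ≡ t * x * h
  rearrange = solve-∀

%≡%⇒≡mod : ∀ {g a b} .{{_ : NonZero g}} → a % g ≡ b % g → a ≡ b mod g
%≡%⇒≡mod {g} {a} {b} eq = b / g , a / g , (begin
  a + b / g * g                 ≡⟨ cong (_+ b / g * g) (m≡m%n+[m/n]*n a g) ⟩
  a % g + a / g * g + b / g * g ≡⟨ cong (λ z → z + a / g * g + b / g * g) eq ⟩
  b % g + a / g * g + b / g * g ≡⟨ +-swapʳ (b % g) (a / g * g) (b / g * g) ⟩
  b % g + b / g * g + a / g * g ≡⟨ cong (_+ a / g * g) (m≡m%n+[m/n]*n b g) ⟨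
  b + a / g * g                 ∎)
  where
  open ≡-Reasoning

<⇒≡mod⇒≡ : ∀ {g a b} → a < g → b < g → a ≡ b mod g → a ≡ b
<⇒≡mod⇒≡ {g} {a} {b} a<g b<g a≡b with ∣ a - b ∣ ≟ 0
... | yes ∣a-b∣≡0 = ∣m-n∣≡0⇒m≡n ∣a-b∣≡0
... | no ∣a-b∣≢0  = contradiction (≡mod⇒∣∣-∣ a≡b)
                      (>⇒∤ {{≢-nonZero ∣a-b∣≢0}} (≤-<-trans (∣m-n∣≤m⊔n a b) (⊔-lub a<g b<g)))

-- Counting solutions of linear congruences

residueClass-count : ∀ {n q} → n ∣ q → ∀ s t → n * natSum q (λ x → 𝟙 (x + s ≡? t mod n)) ≤ q
residueClass-count {n} (divides w refl) s t =
  subst (n * natSum (w * n) (λ x → 𝟙 (x + s ≡? t mod n)) ≤_) (*-comm n w) (*-monoʳ-≤ n (blocks w s))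
  where
  block : ∀ s → natSum n (λ x → 𝟙 (x + s ≡? t mod n)) ≤ 1
  block s = natSum-𝟙≤1 n (λ x → x + s ≡? t mod n) (λ x<n y<n x≡t y≡t →
    <⇒≡mod⇒≡ x<n y<n (≡mod-cancelʳ-+ s (≡mod-trans x≡t (≡mod-sym y≡t))))
  blocks : ∀ w s → natSum (w * n) (λ x → 𝟙 (x + s ≡? t mod n)) ≤ w
  blocks zero    s = z≤n
  blocks (suc w) s = begin
    natSum (n + w * n) (λ x → 𝟙 (x + s ≡? t mod n))
      ≡⟨ natSum-split n (w * n) _ ⟩
    natSum n (λ x → 𝟙 (x + s ≡? t mod n)) + natSum (w * n) (λ x → 𝟙 (n + x + s ≡? t mod n))
      ≡⟨ cong (natSum n _ +_) (∑-cong (natSum-isSummation (w * n)) (λ x →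
           cong (λ z → 𝟙 (z ≡? t mod n)) (shift n x s))) ⟩
    natSum n (λ x → 𝟙 (x + s ≡? t mod n)) + natSum (w * n) (λ x → 𝟙 (x + (n + s) ≡? t mod n))
      ≤⟨ +-mono-≤ (block s) (blocks w (n + s)) ⟩
    suc w ∎
    where
    open ≤-Reasoning
    shift : ∀ n x s → n + x + s ≡ x + (n + s)
    shift = solve-∀

singleClass-count : ∀ {p} {P : Pred ℕ p} (P? : Decidable P) {n q} → n ∣ q →
                    (∀ {x y} → P x → P y → x ≡ y mod n) → n * natSum q (𝟙 ∘ P?) ≤ q
singleClass-count {P = P} P? {n} {q} n∣q oneClass with natSum q (𝟙 ∘ P?) ≟ 0
... | yes none = subst (_≤ q) (sym (trans (cong (n *_) none) (*-zeroʳ n))) z≤n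
... | no some with natSum-𝟙≢0⇒∃ q P? some
...   | x₀ , _ , Px₀ = begin
  n * natSum q (𝟙 ∘ P?)                       ≤⟨ *-monoʳ-≤ n (∑-mono (natSum-isSummation q) (λ x →
                                                   𝟙-mono (inClass x) (P? x) (x + 0 ≡? x₀ mod n))) ⟩
  n * natSum q (λ x → 𝟙 (x + 0 ≡? x₀ mod n))  ≤⟨ residueClass-count n∣q 0 x₀ ⟩
  q                                           ∎
  where
  open ≤-Reasoning
  inClass : ∀ x → P x → x + 0 ≡ x₀ mod n
  inClass x Px = ≡mod-trans (≡⇒≡mod (+-identityʳ x)) (oneClass Px Px₀)

linearCongruence-solvable : ∀ {g k c} v x → k + v * x ≡ c mod g → k ≡ c mod gcd v g
linearCongruence-solvable {g} {k} v x solution = begin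
  k          ≡⟨ +-identityʳ k ⟨
  k + 0      ≈⟨ ≡mod-+ ≡mod-refl (∣⇒*≡0mod x (gcd[m,n]∣m v g)) ⟨
  k + v * x  ≈⟨ ∣⇒≡mod (gcd[m,n]∣n v g) solution ⟩
  _          ∎
  where open ≡mod-Reasoning (gcd v g)

*-cancelˡ-≡mod : ∀ v {g x y} .{{_ : NonZero (gcd v g)}} → v * x ≡ v * y mod g → x ≡ y mod (g / gcd v g)
*-cancelˡ-≡mod v {g} {x} {y} vx≡vy = ∣∣-∣⇒≡mod (coprime-divisor (Coprime.sym (coprime-/gcd v g)) n∣v′∣x-y∣)
  where
  h n v′ : ℕ
  h = gcd v g
  n = g / h
  v′ = v / h
  g∣v∣x-y∣ : g ∣ v * ∣ x - y ∣
  g∣v∣x-y∣ = subst (g ∣_) (sym (*-distribˡ-∣-∣ v x y)) (≡mod⇒∣∣-∣ vx≡vy)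
  n∣v′∣x-y∣ : n ∣ v′ * ∣ x - y ∣
  n∣v′∣x-y∣ = *-cancelˡ-∣ h (subst₂ _∣_ (sym (m*[n/m]≡n (gcd[m,n]∣n v g)))
    (trans (cong (_* ∣ x - y ∣) (sym (m*[n/m]≡n (gcd[m,n]∣m v g)))) (*-assoc h v′ _)) g∣v∣x-y∣)

linearCongruence-sameClass : ∀ v {g k c x y} .{{_ : NonZero (gcd v g)}} →
  k + v * x ≡ c mod g → k + v * y ≡ c mod g → x ≡ y mod (g / gcd v g)
linearCongruence-sameClass v {g} {k} {c} {x} {y} x-sol y-sol = *-cancelˡ-≡mod v (≡mod-cancelʳ-+ k (begin
  v * x + k  ≡⟨ +-comm (v * x) k ⟩
  k + v * x  ≈⟨ x-sol ⟩
  c          ≈⟨ y-sol ⟨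
  k + v * y  ≡⟨ +-comm k (v * y) ⟩
  v * y + k  ∎))
  where open ≡mod-Reasoning g

linearCongruence-count : ∀ {g q} .{{_ : NonZero g}} → g ∣ q → ∀ v k c →
  g * natSum q (λ x → 𝟙 (k + v * x ≡? c mod g)) ≤ 𝟙 (k ≡? c mod gcd v g) * gcd v g * q
linearCongruence-count {g} {q} g∣q v k c with k ≡? c mod gcd v g
... | no unsolvable = ≤-reflexive (trans (cong (g *_) (natSum-zero q _ (λ x _ →
        𝟙-no (unsolvable ∘ linearCongruence-solvable v x) (k + v * x ≡? c mod g)))) (*-zeroʳ g))
... | yes _ = begin
  g * S           ≡⟨ cong (_* S) (m*[n/m]≡n h∣g) ⟨
  h * (g / h) * S ≡⟨ *-assoc h (g / h) S ⟩
  h * (g / h * S) ≤⟨ *-monoʳ-≤ h (singleClass-count _ g/h∣q (linearCongruence-sameClass v)) ⟩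
  h * q           ≡⟨ cong (_* q) (*-identityˡ h) ⟨
  1 * h * q       ∎
  where
  open ≤-Reasoning
  S h : ℕ
  S = natSum q (λ x → 𝟙 (k + v * x ≡? c mod g))
  h = gcd v g
  instance
    h≢0 : NonZero h
    h≢0 = ≢-nonZero (gcd[m,n]≢0 v g (inj₂ (≢-nonZero⁻¹ g)))
  h∣g : h ∣ g
  h∣g = gcd[m,n]∣n v g
  g/h∣q : g / h ∣ q
  g/h∣q = ∣-trans (divides h (sym (m*[n/m]≡n h∣g))) g∣q

gcdAll : ∀ {d} → Vec ℕ d → ℕ → ℕ
gcdAll []       m = m
gcdAll (v ∷ vs) m = gcd v (gcdAll vs m)

gcdAll∣ : ∀ {d} (vs : Vec ℕ d) m → gcdAll vs m ∣ m
gcdAll∣ []       m = ∣-refl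
gcdAll∣ (v ∷ vs) m = ∣-trans (gcd[m,n]∣n v (gcdAll vs m)) (gcdAll∣ vs m)

gcdAll-nonZero : ∀ {d} (vs : Vec ℕ d) m .{{_ : NonZero m}} → NonZero (gcdAll vs m)
gcdAll-nonZero []       m = ≢-nonZero (≢-nonZero⁻¹ m)
gcdAll-nonZero (v ∷ vs) m =
  ≢-nonZero (gcd[m,n]≢0 v (gcdAll vs m) (inj₂ (≢-nonZero⁻¹ (gcdAll vs m) {{gcdAll-nonZero vs m}})))

dot : ∀ {q d} → Vec ℕ d → Point q d → ℕ
dot []       []       = 0
dot (v ∷ vs) (x ∷ xs) = v * toℕ x + dot vs xs

-- Induction on d: fixing the first coordinate leaves a congruence modulo m in the others, and the
-- one-variable count then applies modulo their gcd.
linearCongruenceᵈ-count : ∀ {m q} .{{_ : NonZero m}} → m ∣ q → ∀ d (vs : Vec ℕ d) k c →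
  m * pointSum q d (λ a → 𝟙 (k + dot vs a ≡? c mod m)) ≤ 𝟙 (k ≡? c mod gcdAll vs m) * gcdAll vs m * q ^ d
linearCongruenceᵈ-count {m} m∣q zero [] k c =
  ≤-reflexive (trans (cong (λ z → m * 𝟙 (z ≡? c mod m)) (+-identityʳ k)) (rearrange m (𝟙 (k ≡? c mod m))))
  where
  rearrange : ∀ m i → m * i ≡ i * m * 1
  rearrange = solve-∀
linearCongruenceᵈ-count {m} {q} m∣q (suc d) (v ∷ vs) k c = begin
  m * finSum q (λ x → pointSum q d (λ a → 𝟙 (k + (v * toℕ x + dot vs a) ≡? c mod m)))
    ≡⟨ ∑-*ˡ isF m _ ⟨
  finSum q (λ x → m * pointSum q d (λ a → 𝟙 (k + (v * toℕ x + dot vs a) ≡? c mod m)))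
    ≡⟨ ∑-cong isF (λ x → cong (m *_) (∑-cong (pointSum-isSummation q d) (λ a →
         cong (λ z → 𝟙 (z ≡? c mod m)) (sym (+-assoc k (v * toℕ x) (dot vs a)))))) ⟩
  finSum q (λ x → m * pointSum q d (λ a → 𝟙 (k + v * toℕ x + dot vs a ≡? c mod m)))
    ≤⟨ ∑-mono isF (λ x → linearCongruenceᵈ-count m∣q d vs (k + v * toℕ x) c) ⟩
  finSum q (λ x → 𝟙 (k + v * toℕ x ≡? c mod g) * g * q ^ d)
    ≡⟨ ∑-*ʳ isF (q ^ d) _ ⟩
  finSum q (λ x → 𝟙 (k + v * toℕ x ≡? c mod g) * g) * q ^ d
    ≡⟨ cong (_* q ^ d) (trans (∑-*ʳ isF g _) (cong (_* g) (finSum-toℕ q (λ x → 𝟙 (k + v * x ≡? c mod g))))) ⟩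
  natSum q (λ x → 𝟙 (k + v * x ≡? c mod g)) * g * q ^ d
    ≡⟨ cong (_* q ^ d) (*-comm _ g) ⟩
  g * natSum q (λ x → 𝟙 (k + v * x ≡? c mod g)) * q ^ d
    ≤⟨ *-monoˡ-≤ (q ^ d) (linearCongruence-count {{gcdAll-nonZero vs m}} (∣-trans (gcdAll∣ vs m) m∣q) v k c) ⟩
  𝟙 (k ≡? c mod gcd v g) * gcd v g * q * q ^ d
    ≡⟨ *-assoc (𝟙 (k ≡? c mod gcd v g) * gcd v g) q (q ^ d) ⟩
  𝟙 (k ≡? c mod gcd v g) * gcd v g * (q * q ^ d) ∎
  where
  open ≤-Reasoning
  isF : IsSummation (finSum q)
  isF = finSum-isSummation q
  g : ℕ
  g = gcdAll vs m

-- Geometry of spheres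

sqNormℕ : ∀ {q d} → Point q d → ℕ
sqNormℕ []       = 0
sqNormℕ (x ∷ xs) = toℕ x * toℕ x + sqNormℕ xs

twiceInnerℕ : ∀ {q d} → Point q d → Point q d → ℕ
twiceInnerℕ []       []       = 0
twiceInnerℕ (x ∷ xs) (a ∷ as) = 2 * toℕ x * toℕ a + twiceInnerℕ xs as

bisectorNormal : ∀ {q d} → Point q d → Point q d → Vec ℕ d
bisectorNormal []       []         = []
bisectorNormal (x ∷ xs) (x′ ∷ xs′) = 2 * diffℕ x′ x ∷ bisectorNormal xs xs′

-- diffℕ x a = x + t with a + t = q, so after substituting q = a + t the congruences below
-- become polynomial identities.
diffℕ²≡mod : ∀ {q} (x a : Fin q) →
             diffℕ x a * diffℕ x a + 2 * toℕ x * toℕ a ≡ toℕ x * toℕ x + toℕ a * toℕ a mod q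
diffℕ²≡mod {q} x a = 2 * aₙ , 2 * xₙ + q , subst
  (λ z → (xₙ + t) * (xₙ + t) + 2 * xₙ * aₙ + 2 * aₙ * z ≡ xₙ * xₙ + aₙ * aₙ + (2 * xₙ + z) * z)
  (m+[n∸m]≡n (<⇒≤ (Fin.toℕ<n a))) (identity xₙ aₙ t)
  where
  xₙ aₙ t : ℕ
  xₙ = toℕ x
  aₙ = toℕ a
  t = q ∸ aₙ
  identity : ∀ xₙ aₙ t → (xₙ + t) * (xₙ + t) + 2 * xₙ * aₙ + (2 * aₙ) * (aₙ + t)
                        ≡ xₙ * xₙ + aₙ * aₙ + (2 * xₙ + (aₙ + t)) * (aₙ + t)
  identity = solve-∀

sqDistℕ+twiceInnerℕ≡mod : ∀ {q d} (p a : Point q d) →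
                          sqDistℕ p a + twiceInnerℕ p a ≡ sqNormℕ p + sqNormℕ a mod q
sqDistℕ+twiceInnerℕ≡mod []       []       = ≡mod-refl
sqDistℕ+twiceInnerℕ≡mod (x ∷ p) (a ∷ as) = ≡mod-trans (≡⇒≡mod (+-interchange (diffℕ x a * diffℕ x a) _ _ _))
  (≡mod-trans (≡mod-+ (diffℕ²≡mod x a) (sqDistℕ+twiceInnerℕ≡mod p as))
              (≡⇒≡mod (+-interchange (toℕ x * toℕ x) _ _ _)))

twiceInnerℕ+dot≡mod : ∀ {q d} (p p′ a : Point q d) →
                      twiceInnerℕ p a + dot (bisectorNormal p p′) a ≡ twiceInnerℕ p′ a mod q
twiceInnerℕ+dot≡mod []       []         []       = ≡mod-refl
twiceInnerℕ+dot≡mod {q} (x ∷ p) (x′ ∷ p′) (a ∷ as) =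
  ≡mod-trans (≡⇒≡mod (+-interchange (2 * xₙ * aₙ) (twiceInnerℕ p as) (2 * diffℕ x′ x * aₙ) _))
             (≡mod-+ first-coordinate (twiceInnerℕ+dot≡mod p p′ as))
  where
  xₙ x′ₙ aₙ t : ℕ
  xₙ = toℕ x
  x′ₙ = toℕ x′
  aₙ = toℕ a
  t = q ∸ xₙ
  identity : ∀ xₙ x′ₙ aₙ t → 2 * xₙ * aₙ + 2 * (x′ₙ + t) * aₙ + 0 * (xₙ + t)
                           ≡ 2 * x′ₙ * aₙ + (2 * aₙ) * (xₙ + t)
  identity = solve-∀
  first-coordinate : 2 * xₙ * aₙ + 2 * diffℕ x′ x * aₙ ≡ 2 * x′ₙ * aₙ mod q
  first-coordinate = 0 , 2 * aₙ , subst
    (λ z → 2 * xₙ * aₙ + 2 * (x′ₙ + t) * aₙ + 0 * z ≡ 2 * x′ₙ * aₙ + 2 * aₙ * z)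
    (m+[n∸m]≡n (<⇒≤ (Fin.toℕ<n x))) (identity xₙ x′ₙ aₙ t)

equidistant⇒linear : ∀ {q d} (p p′ a : Point q d) → sqDistℕ p a ≡ sqDistℕ p′ a mod q →
                     sqNormℕ p + dot (bisectorNormal p p′) a ≡ sqNormℕ p′ mod q
equidistant⇒linear {q} p p′ a equidistant = ≡mod-cancelʳ-+ (sqNormℕ a) (begin
  sqNormℕ p + n + sqNormℕ a              ≡⟨ +-swapʳ (sqNormℕ p) n (sqNormℕ a) ⟩
  sqNormℕ p + sqNormℕ a + n              ≈⟨ ≡mod-+ (sqDistℕ+twiceInnerℕ≡mod p a) ≡mod-refl ⟨
  sqDistℕ p a + twiceInnerℕ p a + n      ≡⟨ +-assoc (sqDistℕ p a) (twiceInnerℕ p a) n ⟩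
  sqDistℕ p a + (twiceInnerℕ p a + n)    ≈⟨ ≡mod-+ ≡mod-refl (twiceInnerℕ+dot≡mod p p′ a) ⟩
  sqDistℕ p a + twiceInnerℕ p′ a         ≈⟨ ≡mod-+ equidistant ≡mod-refl ⟩
  sqDistℕ p′ a + twiceInnerℕ p′ a        ≈⟨ sqDistℕ+twiceInnerℕ≡mod p′ a ⟩
  sqNormℕ p′ + sqNormℕ a                 ∎)
  where
  open ≡mod-Reasoning q
  n : ℕ
  n = dot (bisectorNormal p p′) a

-- Divisors of q

smallestPrimeDivisor≤ : ∀ {γ q e} → IsSmallestPrimeDivisor γ q → e ∣ q → 2 ≤ e → γ ≤ e
smallestPrimeDivisor≤ {e = zero} _ _ ()
smallestPrimeDivisor≤ {e = suc e} (_ , _ , minimal) e∣q 2≤e with factorise (suc e)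
... | record { factors = [] ; isFactorisation = e≡1 } = contradiction e≡1 (>⇒≢ 2≤e)
... | record { factors = p ∷ ps ; isFactorisation = e≡p*Πps ; factorsPrime = prime-p ∷ _ } =
  ≤-trans (minimal p prime-p (∣-trans p∣e e∣q)) (∣⇒≤ p∣e)
  where
  p∣e : p ∣ suc e
  p∣e = divides (product ps) (trans e≡p*Πps (*-comm p (product ps)))

odd⇒coprime-2 : ∀ {q e} → ¬ 2 ∣ q → e ∣ q → Coprime e 2
odd⇒coprime-2 odd e∣q {i} (i∣e , i∣2) with i | ∣⇒≤ i∣2 | i∣2 | i∣e
... | zero              | _             | 0∣2 | _   = contradiction (0∣⇒≡0 0∣2) λ ()
... | suc zero          | _             | _   | _   = refl
... | suc (suc zero)    | _             | _   | 2∣e = contradiction (∣-trans 2∣e e∣q) odd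
... | suc (suc (suc _)) | s≤s (s≤s ()) | _   | _

allCoordsDivisible : ∀ {q d} → ℕ → Point q d → Point q d → ℕ
allCoordsDivisible e []       []         = 1
allCoordsDivisible e (x ∷ xs) (x′ ∷ xs′) = 𝟙 (e ∣? diffℕ x′ x) * allCoordsDivisible e xs xs′

∣gcdAll-bisectorNormal⇒allCoordsDivisible : ∀ {q d} (p p′ : Point q d) m e → Coprime e 2 →
  e ∣ gcdAll (bisectorNormal p p′) m → allCoordsDivisible e p p′ ≡ 1
∣gcdAll-bisectorNormal⇒allCoordsDivisible []       []         m e _         _   = refl
∣gcdAll-bisectorNormal⇒allCoordsDivisible (x ∷ p) (x′ ∷ p′) m e e⊥2 e∣gcd = cong₂ _*_
  (𝟙-yes (coprime-divisor e⊥2 (∣-trans e∣gcd (gcd[m,n]∣m (2 * diffℕ x′ x) rest))) (e ∣? diffℕ x′ x))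
  (∣gcdAll-bisectorNormal⇒allCoordsDivisible p p′ m e e⊥2 (∣-trans e∣gcd (gcd[m,n]∣n (2 * diffℕ x′ x) rest)))
  where
  rest : ℕ
  rest = gcdAll (bisectorNormal p p′) m

-- In each coordinate at most q / e of the q choices of x′ satisfy e ∣ x′ - x.
allCoordsDivisible-count : ∀ {q} d (p : Point q d) {e} → e ∣ q → e ^ d * pointSum q d (allCoordsDivisible e p) ≤ q ^ d
allCoordsDivisible-count     zero    []      e∣q = ≤-refl
allCoordsDivisible-count {q} (suc d) (x ∷ p) {e} e∣q = begin
  e * e ^ d * finSum q (λ x′ → pointSum q d (λ v → 𝟙 (e ∣? diffℕ x′ x) * allCoordsDivisible e p v))
    ≡⟨ cong (e * e ^ d *_) (trans (∑-cong isF (λ x′ → ∑-*ˡ (pointSum-isSummation q d) (𝟙 (e ∣? diffℕ x′ x)) _))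
                                  (∑-*ʳ isF rest (λ x′ → 𝟙 (e ∣? diffℕ x′ x)))) ⟩
  e * e ^ d * (first * rest) ≡⟨ rearrange e (e ^ d) first rest ⟩
  (e * first) * (e ^ d * rest) ≤⟨ *-mono-≤ first-coordinate (allCoordsDivisible-count d p e∣q) ⟩
  q * q ^ d ∎
  where
  open ≤-Reasoning
  isF : IsSummation (finSum q)
  isF = finSum-isSummation q
  first rest : ℕ
  first = finSum q (λ x′ → 𝟙 (e ∣? diffℕ x′ x))
  rest = pointSum q d (allCoordsDivisible e p)
  rearrange : ∀ e E F R → e * E * (F * R) ≡ (e * F) * (E * R)
  rearrange = solve-∀
  ∣⇔≡0mod : ∀ n → 𝟙 (e ∣? n) ≡ 𝟙 (n ≡? 0 mod e)
  ∣⇔≡0mod n = 𝟙-cong (∣∣-∣⇒≡mod ∘ subst (e ∣_) (sym (∣-∣-identityʳ n)))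
                     (subst (e ∣_) (∣-∣-identityʳ n) ∘ ≡mod⇒∣∣-∣) (e ∣? n) (n ≡? 0 mod e)
  first-coordinate : e * first ≤ q
  first-coordinate = begin
    e * first                                         ≡⟨ cong (e *_) (finSum-toℕ q (λ j → 𝟙 (e ∣? (j + t)))) ⟩
    e * natSum q (λ j → 𝟙 (e ∣? (j + t)))             ≡⟨ cong (e *_) (∑-cong (natSum-isSummation q) (∣⇔≡0mod ∘ (_+ t))) ⟩
    e * natSum q (λ j → 𝟙 (j + t ≡? 0 mod e))         ≤⟨ residueClass-count e∣q t 0 ⟩
    q                                                 ∎
    where
    t : ℕ
    t = q ∸ toℕ x

module Incidences (q : ℕ) .{{_ : NonZero q}} (d : ℕ) where

  incident : Point q d → Sphere q d → ℕ
  incident p s = 𝟙 (onSphere? p s)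

  pointsOn : List (Point q d) → Sphere q d → ℕ
  pointsOn P s = listSum P (λ p → incident p s)

  incidences≡ : ∀ P S → incidences P S ≡ listSum S (pointsOn P)
  incidences≡ P S = ∑-cong (listSum-isSummation S) (λ s → length-filter (λ p → onSphere? p s) P)

  private
    isS : IsSummation (sphereSum q d)
    isS = sphereSum-isSummation q d

  spheresThrough : ∀ p → sphereSum q d (incident p) ≡ q ^ d
  spheresThrough p = begin
    pointSum q d (λ a → finSum q (λ r → incident p (a , r))) ≡⟨ ∑-cong (pointSum-isSummation q d) oneRadius ⟩
    pointSum q d (λ _ → 1)                                   ≡⟨ pointSum-const q d 1 ⟩
    q ^ d * 1                                                ≡⟨ *-identityʳ (q ^ d) ⟩
    q ^ d                                                    ∎
    where
    open ≡-Reasoning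
    oneRadius : ∀ a → finSum q (λ r → incident p (a , r)) ≡ 1
    oneRadius a = trans (∑-cong (finSum-isSummation q) (λ r → sym (*-identityʳ (incident p (a , r)))))
                        (finSum-sifts-toℕ q (sqDistℕ p a % q) (λ _ → 1) (m%n<n (sqDistℕ p a) q))

  sphereCount : sphereSum q d (λ _ → 1) ≡ q ^ d * q
  sphereCount = trans (∑-cong (pointSum-isSummation q d) (λ _ → trans (finSum-const q 1) (*-identityʳ q)))
                      (pointSum-const q d q)

  sum-pointsOn : ∀ P → sphereSum q d (pointsOn P) ≡ length P * q ^ d
  sum-pointsOn P = begin
    sphereSum q d (pointsOn P)                 ≡⟨ ∑-listSum-comm isS P (λ s p → incident p s) ⟩
    listSum P (λ p → sphereSum q d (incident p)) ≡⟨ ∑-cong (listSum-isSummation P) spheresThrough ⟩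
    listSum P (λ _ → q ^ d)                    ≡⟨ listSum-const P (q ^ d) ⟩
    length P * q ^ d                           ∎
    where open ≡-Reasoning

  commonSpheres : Point q d → Point q d → ℕ
  commonSpheres p p′ = sphereSum q d (λ s → incident p s * incident p′ s)

  pairCount : List (Point q d) → ℕ
  pairCount P = listSum P (λ p → listSum P (commonSpheres p))

  sum-pointsOn² : ∀ P → sphereSum q d (λ s → pointsOn P s * pointsOn P s) ≡ pairCount P
  sum-pointsOn² P = begin
    sphereSum q d (λ s → pointsOn P s * pointsOn P s)
      ≡⟨ ∑-cong isS (λ s → trans (sym (∑-*ʳ isL (pointsOn P s) (λ p → incident p s)))
                                 (∑-cong isL (λ p → sym (∑-*ˡ isL (incident p s) (λ p′ → incident p′ s))))) ⟩
    sphereSum q d (λ s → listSum P (λ p → listSum P (λ p′ → incident p s * incident p′ s)))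
      ≡⟨ ∑-listSum-comm isS P (λ s p → listSum P (λ p′ → incident p s * incident p′ s)) ⟩
    listSum P (λ p → sphereSum q d (λ s → listSum P (λ p′ → incident p s * incident p′ s)))
      ≡⟨ ∑-cong isL (λ p → ∑-listSum-comm isS P (λ s p′ → incident p s * incident p′ s)) ⟩
    pairCount P ∎
    where
    open ≡-Reasoning
    isL : IsSummation (listSum P)
    isL = listSum-isSummation P

  -- k ∈ shiftedDivisors iff suc k ∣ q, so that τ q is its length, and
  -- divisorWeight p p′ = Σ { e | e ∣ q, e > 1, e divides every coordinate of p′ - p }.
  shiftedDivisors : List ℕ
  shiftedDivisors = filter (λ k → suc k ∣? q) (upTo q)

  weight : ℕ → ℕ
  weight zero    = 0
  weight (suc k) = suc (suc k)

  divisorWeight : Point q d → Point q d → ℕ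
  divisorWeight p p′ = listSum shiftedDivisors (λ k → weight k * allCoordsDivisible (suc k) p p′)

  divisor≤1+divisorWeight : ∀ p p′ e → e ∣ q → allCoordsDivisible e p p′ ≡ 1 → e ≤ 1 + divisorWeight p p′
  divisor≤1+divisorWeight p p′ zero          0∣q _         = contradiction (0∣⇒≡0 0∣q) (≢-nonZero⁻¹ q)
  divisor≤1+divisorWeight p p′ (suc zero)    _   _         = s≤s z≤n
  divisor≤1+divisorWeight p p′ (suc (suc k)) e∣q divisible = ≤-trans
    (≤-trans (≤-reflexive (sym term≡e)) (∈⇒≤listSum (λ k → weight k * allCoordsDivisible (suc k) p p′) k+1∈))
    (m≤n+m _ 1)
    where
    k+1∈ : suc k ∈ shiftedDivisors
    k+1∈ = ∈-filter⁺ (λ k → suc k ∣? q) (∈-upTo⁺ (∣⇒≤ e∣q)) e∣q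
    term≡e : weight (suc k) * allCoordsDivisible (suc (suc k)) p p′ ≡ suc (suc k)
    term≡e = trans (cong (suc (suc k) *_) divisible) (*-identityʳ (suc (suc k)))

  commonSpheres≤centres : ∀ p p′ →
    commonSpheres p p′ ≤ pointSum q d (λ a → 𝟙 (sqNormℕ p + dot (bisectorNormal p p′) a ≡? sqNormℕ p′ mod q))
  commonSpheres≤centres p p′ = begin
    commonSpheres p p′
      ≡⟨ ∑-cong isP (λ a → finSum-sifts-toℕ q (D p a) (λ j → 𝟙 (D p′ a ≟ j)) (m%n<n _ q)) ⟩
    pointSum q d (λ a → 𝟙 (D p′ a ≟ D p a))
      ≤⟨ ∑-mono isP (λ a → 𝟙-mono (equidistant a) (D p′ a ≟ D p a) (sqNormℕ p + dot v a ≡? sqNormℕ p′ mod q)) ⟩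
    pointSum q d (λ a → 𝟙 (sqNormℕ p + dot v a ≡? sqNormℕ p′ mod q)) ∎
    where
    open ≤-Reasoning
    isP : IsSummation (pointSum q d)
    isP = pointSum-isSummation q d
    D : Point q d → Point q d → ℕ
    D p a = sqDistℕ p a % q
    v : Vec ℕ d
    v = bisectorNormal p p′
    equidistant : ∀ a → D p′ a ≡ D p a → sqNormℕ p + dot v a ≡ sqNormℕ p′ mod q
    equidistant a eq = equidistant⇒linear p p′ a (%≡%⇒≡mod (sym eq))

  gcdAll-bisectorNormal≤ : ¬ 2 ∣ q → ∀ p p′ → gcdAll (bisectorNormal p p′) q ≤ 1 + divisorWeight p p′
  gcdAll-bisectorNormal≤ odd p p′ = divisor≤1+divisorWeight p p′ G G∣q
    (∣gcdAll-bisectorNormal⇒allCoordsDivisible p p′ q G (odd⇒coprime-2 odd G∣q) ∣-refl)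
    where
    G : ℕ
    G = gcdAll (bisectorNormal p p′) q
    G∣q : G ∣ q
    G∣q = gcdAll∣ (bisectorNormal p p′) q

  commonSpheres≤ : ¬ 2 ∣ q → ∀ p p′ → q * commonSpheres p p′ ≤ (1 + divisorWeight p p′) * q ^ d
  commonSpheres≤ odd p p′ = begin
    q * commonSpheres p p′                           ≤⟨ *-monoʳ-≤ q (commonSpheres≤centres p p′) ⟩
    q * pointSum q d (λ a → 𝟙 (|p|² + dot v a ≡? |p′|² mod q))
                                                     ≤⟨ linearCongruenceᵈ-count ∣-refl d v |p|² |p′|² ⟩
    𝟙 (|p|² ≡? |p′|² mod G) * G * q ^ d              ≤⟨ *-monoˡ-≤ (q ^ d) (*-monoˡ-≤ G (𝟙≤1 (|p|² ≡? |p′|² mod G))) ⟩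
    1 * G * q ^ d                                    ≡⟨ cong (_* q ^ d) (*-identityˡ G) ⟩
    G * q ^ d                                        ≤⟨ *-monoˡ-≤ (q ^ d) (gcdAll-bisectorNormal≤ odd p p′) ⟩
    (1 + divisorWeight p p′) * q ^ d                 ∎
    where
    open ≤-Reasoning
    v : Vec ℕ d
    v = bisectorNormal p p′
    G |p|² |p′|² : ℕ
    G = gcdAll v q
    |p|² = sqNormℕ p
    |p′|² = sqNormℕ p′

  weightedCount : Point q d → ℕ
  weightedCount p = listSum shiftedDivisors (λ k → weight k * pointSum q d (allCoordsDivisible (suc k) p))

  sum-divisorWeight≤ : ∀ P → Unique P → ∀ p → listSum P (divisorWeight p) ≤ weightedCount p
  sum-divisorWeight≤ P uniqueP p = begin
    listSum P (λ p′ → listSum shiftedDivisors (λ k → weight k * divisible k p′))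
      ≡⟨ ∑-listSum-comm (listSum-isSummation P) shiftedDivisors (λ p′ k → weight k * divisible k p′) ⟩
    listSum shiftedDivisors (λ k → listSum P (λ p′ → weight k * divisible k p′))
      ≡⟨ ∑-cong isD (λ k → ∑-*ˡ (listSum-isSummation P) (weight k) (divisible k)) ⟩
    listSum shiftedDivisors (λ k → weight k * listSum P (divisible k))
      ≤⟨ ∑-mono isD (λ k → *-monoʳ-≤ (weight k) (unique⇒listSum≤∑ {_≟_ = _≟ᴾ_}
           (pointSum-isSummation q d) (pointSum-sifts q d) P uniqueP (divisible k))) ⟩
    weightedCount p ∎
    where
    open ≤-Reasoning
    isD : IsSummation (listSum shiftedDivisors)
    isD = listSum-isSummation shiftedDivisors
    divisible : ℕ → Point q d → ℕ
    divisible k = allCoordsDivisible (suc k) p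

  γ^d*weightedCount≤ : ∀ {γ} → IsSmallestPrimeDivisor γ q → ∀ p → γ ^ d * weightedCount p ≤ τ q * (q * q ^ d)
  γ^d*weightedCount≤ {γ} smallest p = begin
    γ ^ d * weightedCount p                             ≡⟨ ∑-*ˡ (listSum-isSummation shiftedDivisors) (γ ^ d) _ ⟨
    listSum shiftedDivisors (λ k → γ ^ d * term k)      ≤⟨ listSum-mono-∈ shiftedDivisors termBound ⟩
    listSum shiftedDivisors (λ _ → q * q ^ d)           ≡⟨ listSum-const shiftedDivisors (q * q ^ d) ⟩
    τ q * (q * q ^ d)                                   ∎
    where
    open ≤-Reasoning
    term : ℕ → ℕ
    term k = weight k * pointSum q d (allCoordsDivisible (suc k) p)
    termBound : ∀ k → k ∈ shiftedDivisors → γ ^ d * term k ≤ q * q ^ d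
    termBound zero    _  = ≤-trans (≤-reflexive (*-zeroʳ (γ ^ d))) z≤n
    termBound (suc k) k∈ = begin
      γ ^ d * (e * C)   ≤⟨ *-monoˡ-≤ (e * C) (^-monoˡ-≤ d (smallestPrimeDivisor≤ smallest e∣q (s≤s (s≤s z≤n)))) ⟩
      e ^ d * (e * C)   ≡⟨ x∙yz≈y∙xz (e ^ d) e C ⟩
      e * (e ^ d * C)   ≤⟨ *-mono-≤ (∣⇒≤ e∣q) (allCoordsDivisible-count d p e∣q) ⟩
      q * q ^ d         ∎
      where
      e C : ℕ
      e = suc (suc k)
      C = pointSum q d (allCoordsDivisible e p)
      e∣q : e ∣ q
      e∣q = proj₂ (∈-filter⁻ (λ k → suc k ∣? q) {xs = upTo q} k∈)

  q*sum-commonSpheres≤ : ¬ 2 ∣ q → ∀ P p →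
    q * listSum P (commonSpheres p) ≤ (length P + listSum P (divisorWeight p)) * q ^ d
  q*sum-commonSpheres≤ odd P p = begin
    q * listSum P (commonSpheres p)                     ≡⟨ ∑-*ˡ isL q (commonSpheres p) ⟨
    listSum P (λ p′ → q * commonSpheres p p′)           ≤⟨ ∑-mono isL (commonSpheres≤ odd p) ⟩
    listSum P (λ p′ → (1 + divisorWeight p p′) * q ^ d) ≡⟨ ∑-*ʳ isL (q ^ d) (λ p′ → 1 + divisorWeight p p′) ⟩
    listSum P (λ p′ → 1 + divisorWeight p p′) * q ^ d   ≡⟨ cong (_* q ^ d) (∑-+ isL (λ _ → 1) (divisorWeight p)) ⟩
    (listSum P (λ _ → 1) + W) * q ^ d                   ≡⟨ cong (λ z → (z + W) * q ^ d) (listSum-const P 1) ⟩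
    (length P * 1 + W) * q ^ d                          ≡⟨ cong (λ z → (z + W) * q ^ d) (*-identityʳ (length P)) ⟩
    (length P + W) * q ^ d                              ∎
    where
    open ≤-Reasoning
    isL : IsSummation (listSum P)
    isL = listSum-isSummation P
    W : ℕ
    W = listSum P (divisorWeight p)

  γ^d*q*sum-commonSpheres≤ : ¬ 2 ∣ q → ∀ {γ} → IsSmallestPrimeDivisor γ q → ∀ P → Unique P → ∀ p →
    γ ^ d * (q * listSum P (commonSpheres p)) ≤ γ ^ d * length P * q ^ d + τ q * (q * q ^ d) * q ^ d
  γ^d*q*sum-commonSpheres≤ odd {γ} smallest P uniqueP p = begin
    γ ^ d * (q * listSum P (commonSpheres p))
      ≤⟨ *-monoʳ-≤ (γ ^ d) (q*sum-commonSpheres≤ odd P p) ⟩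
    γ ^ d * ((n + listSum P (divisorWeight p)) * q ^ d)
      ≤⟨ *-monoʳ-≤ (γ ^ d) (*-monoˡ-≤ (q ^ d) (+-monoʳ-≤ n (sum-divisorWeight≤ P uniqueP p))) ⟩
    γ ^ d * ((n + weightedCount p) * q ^ d)
      ≡⟨ distribute (γ ^ d) n (weightedCount p) (q ^ d) ⟩
    γ ^ d * n * q ^ d + γ ^ d * weightedCount p * q ^ d
      ≤⟨ +-monoʳ-≤ (γ ^ d * n * q ^ d) (*-monoˡ-≤ (q ^ d) (γ^d*weightedCount≤ smallest p)) ⟩
    γ ^ d * n * q ^ d + τ q * (q * q ^ d) * q ^ d ∎
    where
    open ≤-Reasoning
    n : ℕ
    n = length P
    distribute : ∀ g n R E → g * ((n + R) * E) ≡ g * n * E + g * R * E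
    distribute = solve-∀

  γ^d*q*pairCount≤ : ¬ 2 ∣ q → ∀ {γ} → IsSmallestPrimeDivisor γ q → ∀ P → Unique P →
    γ ^ d * (q * pairCount P) ≤ length P * (γ ^ d * length P * q ^ d + τ q * (q * q ^ d) * q ^ d)
  γ^d*q*pairCount≤ odd {γ} smallest P uniqueP = begin
    γ ^ d * (q * pairCount P)                                   ≡⟨ cong (γ ^ d *_) (∑-*ˡ isL q row) ⟨
    γ ^ d * listSum P (λ p → q * row p)                         ≡⟨ ∑-*ˡ isL (γ ^ d) (λ p → q * row p) ⟨
    listSum P (λ p → γ ^ d * (q * row p))                       ≤⟨ ∑-mono isL (γ^d*q*sum-commonSpheres≤ odd smallest P uniqueP) ⟩
    listSum P (λ _ → bound)                                     ≡⟨ listSum-const P bound ⟩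
    length P * bound                                            ∎
    where
    open ≤-Reasoning
    isL : IsSummation (listSum P)
    isL = listSum-isSummation P
    row : Point q d → ℕ
    row p = listSum P (commonSpheres p)
    bound : ℕ
    bound = γ ^ d * length P * q ^ d + τ q * (q * q ^ d) * q ^ d

  deviation : List (Point q d) → Sphere q d → ℕ
  deviation P s = ∣ q * pointsOn P s - length P ∣

  secondMoment : List (Point q d) → ℕ
  secondMoment P = sphereSum q d (λ s → deviation P s * deviation P s)

  secondMoment-identity : ∀ P → let n = length P in
    secondMoment P + 2 * q * n * (n * q ^ d) ≡ q * q * pairCount P + n * n * (q ^ d * q)
  secondMoment-identity P = begin
    Y + 2 * q * n * (n * q ^ d)
      ≡⟨ cong (λ z → Y + 2 * q * n * z) (sum-pointsOn P) ⟨
    Y + 2 * q * n * sphereSum q d c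
      ≡⟨ cong (Y +_) (∑-*ˡ isS (2 * q * n) c) ⟨
    Y + sphereSum q d (λ s → 2 * q * n * c s)
      ≡⟨ ∑-+ isS dev² (λ s → 2 * q * n * c s) ⟨
    sphereSum q d (λ s → dev² s + 2 * q * n * c s)
      ≡⟨ ∑-cong isS (λ s → trans (cong (dev² s +_) (swap q n (c s))) (∣-∣²+2*≡ (q * c s) n)) ⟩
    sphereSum q d (λ s → q * c s * (q * c s) + n * n)
      ≡⟨ ∑-+ isS (λ s → q * c s * (q * c s)) (λ _ → n * n) ⟩
    sphereSum q d (λ s → q * c s * (q * c s)) + sphereSum q d (λ _ → n * n)
      ≡⟨ cong₂ _+_ (trans (∑-cong isS (λ s → square q (c s))) (∑-*ˡ isS (q * q) (λ s → c s * c s)))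
                   (trans (∑-cong isS (λ _ → sym (*-identityʳ (n * n)))) (∑-*ˡ isS (n * n) (λ _ → 1))) ⟩
    q * q * sphereSum q d (λ s → c s * c s) + n * n * sphereSum q d (λ _ → 1)
      ≡⟨ cong₂ (λ a b → q * q * a + n * n * b) (sum-pointsOn² P) sphereCount ⟩
    q * q * pairCount P + n * n * (q ^ d * q) ∎
    where
    open ≡-Reasoning
    n Y : ℕ
    n = length P
    Y = secondMoment P
    c dev² : Sphere q d → ℕ
    c = pointsOn P
    dev² s = deviation P s * deviation P s
    swap : ∀ q n c → 2 * q * n * c ≡ 2 * (q * c) * n
    swap = solve-∀
    square : ∀ q c → q * c * (q * c) ≡ q * q * (c * c)
    square = solve-∀

  γ^d*secondMoment≤ : ¬ 2 ∣ q → ∀ {γ} → IsSmallestPrimeDivisor γ q → ∀ P → Unique P →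
    γ ^ d * secondMoment P ≤ τ q * q ^ (2 * d + 2) * length P
  γ^d*secondMoment≤ odd {γ} smallest P uniqueP = +-cancelʳ-≤ cross (g * secondMoment P) _ (begin
    g * secondMoment P + cross                        ≡⟨ expand g (secondMoment P) q n E ⟩
    g * (secondMoment P + 2 * q * n * (n * E))        ≡⟨ cong (g *_) (secondMoment-identity P) ⟩
    g * (q * q * pairCount P + n * n * (E * q))       ≡⟨ regroup g q (pairCount P) n E ⟩
    q * (g * (q * pairCount P)) + g * (n * n * (E * q))
                                                      ≤⟨ +-monoˡ-≤ _ (*-monoʳ-≤ q (γ^d*q*pairCount≤ odd smallest P uniqueP)) ⟩
    q * (n * (g * n * E + t * (q * E) * E)) + g * (n * n * (E * q))
                                                      ≡⟨ collect g q n E t ⟩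
    t * ((q * E) * (E * q)) * n + cross               ≡⟨ cong (λ z → t * z * n + cross) q^[2d+2] ⟨
    t * q ^ (2 * d + 2) * n + cross                   ∎)
    where
    open ≤-Reasoning
    g n E t cross : ℕ
    g = γ ^ d
    n = length P
    E = q ^ d
    t = τ q
    cross = 2 * (g * (n * n * (E * q)))
    q^[2d+2] : q ^ (2 * d + 2) ≡ (q * q ^ d) * (q ^ d * q)
    q^[2d+2] = trans (cong (q ^_) (2d+2≡ d))
                     (trans (^-distribˡ-+-* q (suc d) (suc d)) (cong (q * q ^ d *_) (*-comm q (q ^ d))))
      where
      2d+2≡ : ∀ d → 2 * d + 2 ≡ suc d + suc d
      2d+2≡ = solve-∀
    expand : ∀ g Y q n E → g * Y + 2 * (g * (n * n * (E * q))) ≡ g * (Y + 2 * q * n * (n * E))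
    expand = solve-∀
    regroup : ∀ g q A n E → g * (q * q * A + n * n * (E * q)) ≡ q * (g * (q * A)) + g * (n * n * (E * q))
    regroup = solve-∀
    collect : ∀ g q n E t → q * (n * (g * n * E + t * (q * E) * E)) + g * (n * n * (E * q))
                          ≡ t * ((q * E) * (E * q)) * n + 2 * (g * (n * n * (E * q)))
    collect = solve-∀

  ∣q*incidences-nm∣≤ : ∀ P S → ∣ q * incidences P S - length P * length S ∣ ≤ listSum S (deviation P)
  ∣q*incidences-nm∣≤ P S = begin
    ∣ q * incidences P S - n * m ∣                     ≡⟨ cong₂ ∣_-_∣ (cong (q *_) (incidences≡ P S)) (*-comm n m) ⟩
    ∣ q * listSum S (pointsOn P) - m * n ∣             ≡⟨ cong₂ ∣_-_∣ (∑-*ˡ isL q (pointsOn P)) (listSum-const S n) ⟨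
    ∣ listSum S (λ s → q * pointsOn P s) - listSum S (λ _ → n) ∣
                                                       ≤⟨ ∣listSum-listSum∣≤ S (λ s → q * pointsOn P s) (λ _ → n) ⟩
    listSum S (deviation P)                            ∎
    where
    open ≤-Reasoning
    n m : ℕ
    n = length P
    m = length S
    isL : IsSummation (listSum S)
    isL = listSum-isSummation S

theorem1p3 : (q d : ℕ) → .{{_ : NonZero q}} → 1 < q → ¬ (2 ∣ q) → 1 ≤ d →
    (γ : ℕ) → IsSmallestPrimeDivisor γ q →
    (P : List (Point q d)) → Unique P →
    (S : List (Sphere q d)) → Unique S →
    γ ^ d * (∣ q * incidences P S - length P * length S ∣ ^ 2)
    ≤ 2 * τ q * q ^ (2 * d + 2) * (length P * length S)
theorem1p3 q d _ odd _ γ smallest P uniqueP S uniqueS = begin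
  γ ^ d * (X ^ 2)                     ≡⟨ cong (λ z → γ ^ d * (X * z)) (*-identityʳ X) ⟩
  γ ^ d * (X * X)                     ≤⟨ *-monoʳ-≤ (γ ^ d) (*-mono-≤ X≤ X≤) ⟩
  γ ^ d * (Δ * Δ)                     ≤⟨ *-monoʳ-≤ (γ ^ d) (cauchy-schwarz S (deviation P)) ⟩
  γ ^ d * (m * listSum S deviation²)  ≤⟨ *-monoʳ-≤ (γ ^ d) (*-monoʳ-≤ m (unique⇒listSum≤∑ {_≟_ = _≟ˢ_}
                                           (sphereSum-isSummation q d) (sphereSum-sifts q d) S uniqueS deviation²)) ⟩
  γ ^ d * (m * secondMoment P)        ≡⟨ x∙yz≈y∙xz (γ ^ d) m (secondMoment P) ⟩
  m * (γ ^ d * secondMoment P)        ≤⟨ *-monoʳ-≤ m (γ^d*secondMoment≤ odd smallest P uniqueP) ⟩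
  m * (τ q * q ^ (2 * d + 2) * n)     ≤⟨ m≤n+m _ _ ⟩
  m * (τ q * q ^ (2 * d + 2) * n) + m * (τ q * q ^ (2 * d + 2) * n)
                                      ≡⟨ double m (τ q) (q ^ (2 * d + 2)) n ⟩
  2 * τ q * q ^ (2 * d + 2) * (n * m) ∎
  where
  open ≤-Reasoning
  open Incidences q d
  n m X Δ : ℕ
  n = length P
  m = length S
  X = ∣ q * incidences P S - n * m ∣
  Δ = listSum S (deviation P)
  deviation² : Sphere q d → ℕ
  deviation² s = deviation P s * deviation P s
  X≤ : X ≤ Δ
  X≤ = ∣q*incidences-nm∣≤ P S
  double : ∀ m t Q n → m * (t * Q * n) + m * (t * Q * n) ≡ 2 * t * Q * (n * m)
  double = solve-∀
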